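{- On any request sequence respecting the path access graph $P_{k+1}$, FIFO incurs at most $k+1$ faults on any $2k$ consecutive requests.
   Context: Paging: a cache of size $k\ge1$, initially empty; on a request to a page not in cache (a fault) the page is brought in, evicting a page if the cache is full. FIFO evicts, on a fault with full cache, the page that has been in cache the longest. An access graph is an undirected graph whose vertices are the pages; a sequence respects it if any two consecutive requests are to the same page or to adjacent vertices. $P_{k+1}$ is the path graph on $k+1$ vertices. -}

module Defs where

open import Data.Nat using (ℕ; zero; suc; _+_; _<_)
open import Data.Nat.Properties using (_<?_)
open import Data.Fin using (Fin; toℕ)
open import Data.Fin.Properties using (_≟_)
open import Data.List using (List; []; _∷_; length; _++_; [_]; drop; take)
open import Data.List.Relation.Unary.Any using (any?)
open import Data.Bool using (Bool; true; false)
open import Data.Product using (_×_; _,_)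
open import Data.Sum using (_⊎_)
open import Relation.Binary.PropositionalEquality using (_≡_)
open import Relation.Nullary using (does)

-- Pages of the path access graph P_{k+1}: vertices 0,1,…,k, i.e. Fin (suc k).
-- Two vertices are adjacent in the path iff their indices differ by exactly 1.
PathAdj : ∀ {n} → Fin n → Fin n → Set
PathAdj i j = (suc (toℕ i) ≡ toℕ j) ⊎ (suc (toℕ j) ≡ toℕ i)

data RespectsPath {n : ℕ} : List (Fin n) → Set where
  resp-[]  : RespectsPath []
  resp-one : ∀ p → RespectsPath (p ∷ [])
  resp-∷   : ∀ p q σ → (p ≡ q ⊎ PathAdj p q) →
             RespectsPath (q ∷ σ) → RespectsPath (p ∷ q ∷ σ)

-- FIFO cache contents as a queue, oldest page first.
fifoStep : ∀ {n} → ℕ → List (Fin n) → Fin n → Bool × List (Fin n)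
fifoStep k cache p with does (any? (p ≟_) cache)
... | true  = false , cache
... | false with does (length cache <? k)
...   | true  = true , cache ++ [ p ]
...   | false with cache
...     | []      = true , [ p ]
...     | _ ∷ cs  = true , cs ++ [ p ]

fifoFaultsFrom : ∀ {n} → ℕ → List (Fin n) → List (Fin n) → List Bool
fifoFaultsFrom k cache []      = []
fifoFaultsFrom k cache (p ∷ σ) with fifoStep k cache p
... | b , cache' = b ∷ fifoFaultsFrom k cache' σ

fifoFaults : ∀ {n} → ℕ → List (Fin n) → List Bool
fifoFaults k σ = fifoFaultsFrom k [] σ

countTrue : List Bool → ℕ
countTrue []           = 0
countTrue (true ∷ bs)  = suc (countTrue bs)
countTrue (false ∷ bs) = countTrue bs

module Submission where

-- Suppose a window τ causes k + 2 faults, the first one on page p.  FIFO keeps the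
-- cache as a queue and only evicts its head, so p, appended at the back, is evicted by
-- the k-th fault after it was loaded; then the cache holds k pages other than p, i.e.
-- all other pages, each requested after p.  So the (k+2)-nd fault is a request to p,
-- and in between the walk on the path visited every page, in particular both ends 0
-- and k.  A closed walk through both ends of P_{k+1} has length at least 2k, so τ has
-- at least 2k + 1 requests.

open import Defs
open import Data.Nat using (ℕ; zero; suc; _+_; _*_; _≤_; _<_; _<ᵇ_; z≤n; s≤s; s≤s⁻¹; ∣_-_∣)
open import Data.Nat.Properties
  using ( +-commutativeSemigroup; ≤-reflexive; ≤-trans; +-monoˡ-≤; +-suc; +-comm; +-identityʳ
        ; +-cancelʳ-≤; m≤m+n; m≤n⇒m≤1+n; <⇒≱; m⊓n≤m; 1+n≰n; ≤-antisym; ≮⇒≥; _<?_; _≤?_; ≰⇒>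
        ; ∣n-n∣≡0; ∣-∣-comm; ∣-∣-triangle; <ᵇ⇒<; <⇒<ᵇ; module ≤-Reasoning)
open import Algebra.Properties.CommutativeSemigroup +-commutativeSemigroup using (xy∙z≈xz∙y)
open import Data.Fin as F using (Fin; toℕ; fromℕ)
open import Data.Fin.Properties using (_≟_; toℕ-fromℕ; injective⇒≤)
open import Data.List using (List; []; _∷_; length; _++_; [_]; take; drop; lookup)
open import Data.List.Properties using (length-++; ++-assoc; length-take; take++drop≡id)
open import Data.List.Membership.Propositional using (_∈_; _∉_)
open import Data.List.Membership.Propositional.Properties using (∈-++⁺ˡ; ∈-++⁻; ∈-∃++; ∈-lookup)
open import Data.List.Relation.Unary.Any using (here; there; any?)
open import Data.List.Relation.Unary.All as All using ([])
open import Data.List.Relation.Unary.All.Properties using (¬Any⇒All¬)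
open import Data.List.Relation.Unary.AllPairs using ([]; _∷_)
open import Data.List.Relation.Unary.Unique.Propositional using (Unique)
open import Data.List.Relation.Unary.Unique.Propositional.Properties as Unique
  using (Unique[x∷xs]⇒x∉xs)
open import Data.Bool using (true; false)
open import Data.Product using (_×_; _,_; ∃; ∃₂; proj₁; proj₂)
open import Data.Sum as Sum using (_⊎_; inj₁; inj₂; [_,_]′)
open import Data.Unit using (tt)
open import Function using (_∘_)
open import Relation.Binary.PropositionalEquality
  using (_≡_; _≢_; refl; sym; trans; cong; cong₂; subst; subst₂)
open import Relation.Nullary using (¬_; yes; no; contradiction)

dist : ∀ {n} → Fin n → Fin n → ℕ
dist p q = ∣ toℕ p - toℕ q ∣

dist-self : ∀ {n} (p : Fin n) → dist p p ≡ 0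
dist-self p = ∣n-n∣≡0 (toℕ p)

dist-comm : ∀ {n} (p q : Fin n) → dist p q ≡ dist q p
dist-comm p q = ∣-∣-comm (toℕ p) (toℕ q)

dist-triangle : ∀ {n} (p q r : Fin n) → dist p r ≤ dist p q + dist q r
dist-triangle p q r = ∣-∣-triangle (toℕ p) (toℕ q) (toℕ r)

∣n-1+n∣≡1 : ∀ n → ∣ n - suc n ∣ ≡ 1
∣n-1+n∣≡1 zero    = refl
∣n-1+n∣≡1 (suc n) = ∣n-1+n∣≡1 n

move-dist : ∀ {n} {p q : Fin n} → (p ≡ q ⊎ PathAdj p q) → dist p q ≤ 1
move-dist {p = p} (inj₁ refl) = ≤-trans (≤-reflexive (dist-self p)) z≤n
move-dist {p = p} {q} (inj₂ (inj₁ p+1≡q)) rewrite sym p+1≡q = ≤-reflexive (∣n-1+n∣≡1 (toℕ p))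
move-dist {p = p} {q} (inj₂ (inj₂ q+1≡p)) rewrite sym q+1≡p =
  ≤-reflexive (trans (∣-∣-comm (suc (toℕ q)) (toℕ q)) (∣n-1+n∣≡1 (toℕ q)))

move-away : ∀ {n} {u v : Fin n} → (u ≡ v ⊎ PathAdj u v) → ∀ y → dist u y ≤ suc (dist v y)
move-away {u = u} {v} m y = ≤-trans (dist-triangle u v y) (+-monoˡ-≤ (dist v y) (move-dist m))

lastOf : ∀ {A : Set} → A → List A → A
lastOf u []      = u
lastOf u (v ∷ w) = lastOf v w

lastOf-snoc : ∀ {A : Set} (u : A) w v → lastOf u (w ++ [ v ]) ≡ v
lastOf-snoc u []      v = refl
lastOf-snoc u (x ∷ w) v = lastOf-snoc x w v

walk-dist : ∀ {n} {u : Fin n} {w} → RespectsPath (u ∷ w) → dist u (lastOf u w) ≤ length w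
walk-dist {u = u} {[]} _ = ≤-reflexive (dist-self u)
walk-dist {u = u} {v ∷ w} (resp-∷ _ _ _ m r) =
  ≤-trans (move-away m (lastOf v w)) (s≤s (walk-dist r))

visit-dist : ∀ {n} {u y : Fin n} {w} → RespectsPath (u ∷ w) → y ∈ u ∷ w →
             dist u y + dist y (lastOf u w) ≤ length w
visit-dist {u = u} {w = w} r (here refl) =
  ≤-trans (≤-reflexive (cong (_+ dist u (lastOf u w)) (dist-self u))) (walk-dist r)
visit-dist {y = y} {v ∷ w} (resp-∷ _ _ _ m r) (there y∈) =
  ≤-trans (+-monoˡ-≤ _ (move-away m y)) (s≤s (visit-dist r y∈))

two-visit-dist : ∀ {n} {u y z : Fin n} {w} → RespectsPath (u ∷ w) → y ∈ u ∷ w → z ∈ u ∷ w →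
  (dist u y + dist y z + dist z (lastOf u w) ≤ length w) ⊎
  (dist u z + dist z y + dist y (lastOf u w) ≤ length w)
two-visit-dist {u = u} {z = z} {w} r (here refl) z∈ =
  inj₁ (≤-trans (≤-reflexive (cong (λ d → d + dist u z + dist z (lastOf u w)) (dist-self u)))
                (visit-dist r z∈))
two-visit-dist {u = u} {y} {w = w} r y∈ (here refl) =
  inj₂ (≤-trans (≤-reflexive (cong (λ d → d + dist u y + dist y (lastOf u w)) (dist-self u)))
                (visit-dist r y∈))
two-visit-dist {u = u} {y} {z} {v ∷ w} (resp-∷ _ _ _ m r) (there y∈) (there z∈) =
  Sum.map (extend y) (extend z) (two-visit-dist r y∈ z∈)
  where
  extend : ∀ a {b c} → dist v a + b + c ≤ length w → dist u a + b + c ≤ suc (length w)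
  extend a {b} {c} h = ≤-trans (+-monoˡ-≤ c (+-monoˡ-≤ b (move-away m a))) (s≤s h)

round-trip : ∀ {n} (u a b : Fin n) → dist a b + dist a b ≤ dist u a + dist a b + dist b u
round-trip u a b = begin
  dist a b + dist a b             ≤⟨ +-monoˡ-≤ (dist a b) (dist-triangle a u b) ⟩
  dist a u + dist u b + dist a b  ≡⟨ cong₂ (λ x y → x + y + dist a b)
                                            (dist-comm a u) (dist-comm u b) ⟩
  dist u a + dist b u + dist a b  ≡⟨ xy∙z≈xz∙y (dist u a) (dist b u) (dist a b) ⟩
  dist u a + dist a b + dist b u  ∎
  where open ≤-Reasoning

closed-walk-dist : ∀ {n} {u y z : Fin n} {w} → RespectsPath (u ∷ w) → lastOf u w ≡ u →
                   y ∈ u ∷ w → z ∈ u ∷ w → dist y z + dist y z ≤ length w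
closed-walk-dist {u = u} {y} {z} r closed y∈ z∈ with two-visit-dist r y∈ z∈
... | inj₁ h = ≤-trans (round-trip u y z) (subst (λ v → _ + dist z v ≤ _) closed h)
... | inj₂ h = ≤-trans (subst (λ d → d + d ≤ dist u z + dist z y + dist y u) (dist-comm z y)
                              (round-trip u z y))
                       (subst (λ v → _ + dist y v ≤ _) closed h)

tour-length : ∀ {k} {u : Fin (suc k)} {w} → RespectsPath (u ∷ w) → lastOf u w ≡ u →
              F.zero ∈ u ∷ w → fromℕ k ∈ u ∷ w → k + k ≤ length w
tour-length {k} {w = w} r closed 0∈ k∈ =
  subst (λ d → d + d ≤ length w) (toℕ-fromℕ k) (closed-walk-dist r closed 0∈ k∈)

resp-tail : ∀ {n} {p : Fin n} {τ} → RespectsPath (p ∷ τ) → RespectsPath τ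
resp-tail (resp-one _)         = resp-[]
resp-tail (resp-∷ _ _ _ _ r) = r

resp-drop : ∀ {n} i {σ : List (Fin n)} → RespectsPath σ → RespectsPath (drop i σ)
resp-drop zero            r = r
resp-drop (suc i) {[]}    r = r
resp-drop (suc i) {_ ∷ _} r = resp-drop i (resp-tail r)

resp-prefix : ∀ {n} (xs : List (Fin n)) {ys} → RespectsPath (xs ++ ys) → RespectsPath xs
resp-prefix []           _                    = resp-[]
resp-prefix (x ∷ [])     _                    = resp-one x
resp-prefix (x ∷ y ∷ xs) (resp-∷ _ _ _ xy r) = resp-∷ x y xs xy (resp-prefix (y ∷ xs) r)

resp-take : ∀ {n} m {σ : List (Fin n)} → RespectsPath σ → RespectsPath (take m σ)
resp-take m {σ} r = resp-prefix (take m σ) (subst RespectsPath (sym (take++drop≡id m σ)) r)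

return-trip : ∀ {k} (p : Fin (suc k)) w rest → RespectsPath (p ∷ w ++ p ∷ rest) →
              (∀ y → y ≢ p → y ∈ w) → suc (k + k) ≤ length (p ∷ w ++ p ∷ rest)
return-trip {k} p w rest r others = begin
  suc (k + k)                          ≤⟨ s≤s (tour-length loop-resp (lastOf-snoc p w p)
                                                 (visited F.zero) (visited (fromℕ k))) ⟩
  length loop                          ≤⟨ m≤m+n (length loop) (length rest) ⟩
  length loop + length rest            ≡⟨ sym (length-++ loop) ⟩
  length (loop ++ rest)                ≡⟨ cong length loop-split ⟩
  length (p ∷ w ++ p ∷ rest)           ∎
  where
  open ≤-Reasoning
  loop : List (Fin (suc k))
  loop = p ∷ w ++ [ p ]

  loop-split : loop ++ rest ≡ p ∷ w ++ p ∷ rest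
  loop-split = cong (p ∷_) (++-assoc w [ p ] rest)

  loop-resp : RespectsPath loop
  loop-resp = resp-prefix loop (subst RespectsPath (sym loop-split) r)

  visited : ∀ y → y ∈ loop
  visited y with y ≟ p
  ... | yes refl = here refl
  ... | no y≢p  = there (∈-++⁺ˡ (others y y≢p))

-- The caches FIFO can reach: no page twice and at most k pages.
Valid : ∀ {n} → ℕ → List (Fin n) → Set
Valid k c = Unique c × length c ≤ k

lookup-injective : ∀ {A : Set} {xs : List A} → Unique xs →
                   ∀ {i j} → lookup xs i ≡ lookup xs j → i ≡ j
lookup-injective (x≢xs ∷ _) {F.zero}  {F.zero}  _  = refl
lookup-injective (x≢xs ∷ _) {F.zero}  {F.suc j} eq = contradiction eq (All.lookup x≢xs (∈-lookup j))
lookup-injective (x≢xs ∷ _) {F.suc i} {F.zero}  eq =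
  contradiction (sym eq) (All.lookup x≢xs (∈-lookup i))
lookup-injective (_ ∷ u)    {F.suc i} {F.suc j} eq = cong F.suc (lookup-injective u eq)

unique-length : ∀ {n} {xs : List (Fin n)} → Unique xs → length xs ≤ n
unique-length u = injective⇒≤ (lookup-injective u)

unique-∷ : ∀ {A : Set} {x : A} {xs} → x ∉ xs → Unique xs → Unique (x ∷ xs)
unique-∷ {xs = xs} x∉xs u = ¬Any⇒All¬ xs x∉xs ∷ u

unique-snoc : ∀ {A : Set} {xs : List A} {p} → Unique xs → p ∉ xs → Unique (xs ++ [ p ])
unique-snoc u p∉xs = Unique.++⁺ u ([] ∷ []) λ { (p∈xs , here refl) → p∉xs p∈xs }

length-snoc : ∀ {A : Set} (xs : List A) x → length (xs ++ [ x ]) ≡ suc (length xs)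
length-snoc xs x = trans (length-++ xs) (+-comm (length xs) 1)

full-cache-covers : ∀ {k} {x : Fin (suc k)} {c} → Unique c → length c ≡ k → x ∉ c →
                    ∀ y → y ≢ x → y ∈ c
full-cache-covers {k} {x} {c} u c≡k x∉c y y≢x with any? (y ≟_) c
... | yes y∈c = y∈c
... | no  y∉c = contradiction too-many 1+n≰n
  where
  y∉x∷c : y ∉ x ∷ c
  y∉x∷c (here y≡x)  = y≢x y≡x
  y∉x∷c (there y∈c) = y∉c y∈c

  too-many : suc (suc k) ≤ suc k
  too-many = subst (λ l → suc (suc l) ≤ suc k) c≡k (unique-length (unique-∷ y∉x∷c (unique-∷ x∉c u)))

module _ {n} (k : ℕ) {p : Fin n} where

  hit-step : ∀ {c} → p ∈ c → fifoStep k c p ≡ (false , c)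
  hit-step {c} p∈c with any? (_≟_ p) c
  ... | yes _   = refl
  ... | no p∉c = contradiction p∈c p∉c

  fill-step : ∀ {c} → p ∉ c → length c < k → fifoStep k c p ≡ (true , c ++ [ p ])
  fill-step {c} p∉c c<k with any? (_≟_ p) c
  ... | yes p∈c = contradiction p∈c p∉c
  ... | no _ with length c <ᵇ k | <⇒<ᵇ c<k
  ...   | true | _ = refl

  evict-step : ∀ {c q cs} → c ≡ q ∷ cs → p ∉ c → ¬ length c < k →
               fifoStep k c p ≡ (true , cs ++ [ p ])
  evict-step {c} c≡q∷cs p∉c c≮k with any? (_≟_ p) c
  ... | yes p∈c = contradiction p∈c p∉c
  ... | no _ with length c <ᵇ k | <ᵇ⇒< (length c) k
  ...   | true  | c<k = contradiction (c<k tt) c≮k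
  ...   | false | _   with c≡q∷cs
  ...     | refl = refl

data StepView {n} (k : ℕ) : List (Fin n) → Fin n → Set where
  hit   : ∀ {c p} → p ∈ c → fifoStep k c p ≡ (false , c) → StepView k c p
  fill  : ∀ {c p} → p ∉ c → length c < k →
          fifoStep k c p ≡ (true , c ++ [ p ]) → StepView k c p
  evict : ∀ {q cs p} → p ∉ q ∷ cs → length (q ∷ cs) ≡ k →
          fifoStep k (q ∷ cs) p ≡ (true , cs ++ [ p ]) → StepView k (q ∷ cs) p

stepView : ∀ {n k} {c : List (Fin n)} → 1 ≤ k → length c ≤ k → ∀ p → StepView k c p
stepView {k = k} {[]} k≥1 _ p = fill (λ ()) k≥1 (fill-step k {c = []} (λ ()) k≥1)
stepView {k = k} {c@(q ∷ cs)} k≥1 c≤k p with any? (p ≟_) c | length c <? k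
... | yes p∈c | _        = hit p∈c (hit-step k p∈c)
... | no  p∉c | yes c<k = fill p∉c c<k (fill-step k p∉c c<k)
... | no  p∉c | no  c≮k = evict p∉c (≤-antisym c≤k (≮⇒≥ c≮k)) (evict-step k refl p∉c c≮k)

fill-valid : ∀ {n k} {c : List (Fin n)} {p} → Valid k c → p ∉ c → length c < k →
             Valid k (c ++ [ p ])
fill-valid {k = k} {c} {p} (u , _) p∉c c<k =
  unique-snoc u p∉c , subst (_≤ k) (sym (length-snoc c p)) c<k

evict-valid : ∀ {n k} {q : Fin n} {cs p} → Valid k (q ∷ cs) → p ∉ q ∷ cs → Valid k (cs ++ [ p ])
evict-valid {k = k} {cs = cs} {p} (_ ∷ u , c≤k) p∉c =
  unique-snoc u (p∉c ∘ there) , subst (_≤ k) (sym (length-snoc cs p)) c≤k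

step-valid : ∀ {n k} {c : List (Fin n)} → 1 ≤ k → Valid k c → ∀ p →
             Valid k (proj₂ (fifoStep k c p))
step-valid {k = k} {c} k≥1 v p with stepView k≥1 (proj₂ v) p
... | hit _ e        = subst (Valid k ∘ proj₂) (sym e) v
... | fill p∉c c<k e = subst (Valid k ∘ proj₂) (sym e) (fill-valid v p∉c c<k)
... | evict p∉c _ e  = subst (Valid k ∘ proj₂) (sym e) (evict-valid v p∉c)

faults : ∀ {n} → ℕ → List (Fin n) → List (Fin n) → ℕ
faults k c τ = countTrue (fifoFaultsFrom k c τ)

faults-step : ∀ {n k} (c : List (Fin n)) p τ {b c'} → fifoStep k c p ≡ (b , c') →
              faults k c (p ∷ τ) ≡ countTrue (b ∷ fifoFaultsFrom k c' τ)
faults-step c p τ e rewrite e = refl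

take-run : ∀ {n} k m (c : List (Fin n)) τ →
           take m (fifoFaultsFrom k c τ) ≡ fifoFaultsFrom k c (take m τ)
take-run k zero    c τ       = refl
take-run k (suc m) c []      = refl
take-run k (suc m) c (p ∷ τ) with fifoStep k c p
... | b , c' = cong (b ∷_) (take-run k m c' τ)

suffix-run : ∀ {n k} → 1 ≤ k → {c : List (Fin n)} → Valid k c → ∀ i σ →
             ∃ λ c' → Valid k c' × drop i (fifoFaultsFrom k c σ) ≡ fifoFaultsFrom k c' (drop i σ)
suffix-run _   {c} v zero    σ       = c , v , refl
suffix-run _   {c} v (suc i) []      = c , v , refl
suffix-run {k = k} k≥1 {c} v (suc i) (p ∷ σ) with fifoStep k c p | step-valid k≥1 v p
... | _ , c' | v' = suffix-run k≥1 v' i σ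

uncached-is-missing : ∀ {n} {x p : Fin n} {c} → (∀ y → y ≢ x → y ∈ c) → p ∉ c → p ≡ x
uncached-is-missing {x = x} {p} others p∉c with p ≟ x
... | yes p≡x = p≡x
... | no  p≢x = contradiction (others p p≢x) p∉c

missing-page-requested : ∀ {n k} {x : Fin n} {c} → 1 ≤ k → length c ≤ k →
                         (∀ y → y ≢ x → y ∈ c) → ∀ τ → 1 ≤ faults k c τ → x ∈ τ
missing-page-requested {c = c} k≥1 c≤k others (p ∷ τ) h with stepView k≥1 c≤k p
... | hit _ e       =
  there (missing-page-requested k≥1 c≤k others τ (subst (1 ≤_) (faults-step c p τ e) h))
... | fill p∉c _ _  = here (sym (uncached-is-missing others p∉c))
... | evict p∉c _ _ = here (sym (uncached-is-missing others p∉c))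

Returns : ∀ {n} → Fin n → List (Fin n) → List (Fin n) → Set
Returns x b τ = ∃₂ λ w rest → τ ≡ w ++ x ∷ rest × (∀ y → y ≢ x → y ∈ b ⊎ y ∈ w)

returns-∷ : ∀ {n} {x p : Fin n} {b τ} → Returns x b τ → Returns x b (p ∷ τ)
returns-∷ {p = p} (w , rest , τ≡ , seen) =
  p ∷ w , rest , cong (p ∷_) τ≡ , λ y y≢x → Sum.map₂ there (seen y y≢x)

returns-snoc : ∀ {n} {x p : Fin n} {b τ} → Returns x (b ++ [ p ]) τ → Returns x b (p ∷ τ)
returns-snoc {p = p} {b} (w , rest , τ≡ , seen) =
  p ∷ w , rest , cong (p ∷_) τ≡ , λ y y≢x → shift (seen y y≢x)
  where
  shift : ∀ {y} → y ∈ b ++ [ p ] ⊎ y ∈ w → y ∈ b ⊎ y ∈ p ∷ w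
  shift (inj₂ y∈w) = inj₂ (there y∈w)
  shift (inj₁ y∈b++p) with ∈-++⁻ b y∈b++p
  ... | inj₁ y∈b         = inj₁ y∈b
  ... | inj₂ (here refl) = inj₂ (here refl)

returns-to : ∀ {n} {x : Fin n} {b τ} → (∀ y → y ≢ x → y ∈ b) → x ∈ τ → Returns x b τ
returns-to others x∈τ with ∈-∃++ x∈τ
... | w , rest , τ≡ = w , rest , τ≡ , λ y y≢x → inj₁ (others y y≢x)

fault-bound : ∀ {n k} (c : List (Fin n)) p τ {c' m l} → fifoStep k c p ≡ (true , c') →
              m < faults k c (p ∷ τ) + l → m ≤ faults k c' τ + l
fault-bound c p τ e h = s≤s⁻¹ (≤-trans h (≤-reflexive (cong (_+ _) (faults-step c p τ e))))

-- When a request to p evicts x from the full queue x ∷ b, every page but x is cached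
-- afterwards, so the next fault brings x back.
evicted-page-returns : ∀ {k} {x p : Fin (suc k)} {b} → 1 ≤ k → Valid k (x ∷ b) → p ∉ x ∷ b →
                       length (x ∷ b) ≡ k → ∀ τ → 1 ≤ faults k (b ++ [ p ]) τ →
                       Returns x b (p ∷ τ)
evicted-page-returns {k} {x} {p} {b} k≥1 v p∉c c≡k τ one-more =
  returns-snoc (returns-to others (missing-page-requested k≥1 (proj₂ v') others τ one-more))
  where
  v' : Valid k (b ++ [ p ])
  v' = evict-valid v p∉c

  x∉b++p : x ∉ b ++ [ p ]
  x∉b++p x∈ with ∈-++⁻ b x∈
  ... | inj₁ x∈b         = Unique[x∷xs]⇒x∉xs (proj₁ v) x∈b
  ... | inj₂ (here refl) = p∉c (here refl)

  others : ∀ y → y ≢ x → y ∈ b ++ [ p ]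
  others = full-cache-covers (proj₁ v') (trans (length-snoc b p) c≡k) x∉b++p

-- FIFO evicts x by the (k - |c|) + |a| + 1-st
-- fault from now, leaving every page but x cached, and each of those pages is either
-- in b or was requested meanwhile.  So one further fault in τ is a request to x.
tracked-page-returns : ∀ {k} (x : Fin (suc k)) → 1 ≤ k → ∀ {c} a b → c ≡ a ++ x ∷ b →
                       Valid k c → ∀ τ → k + suc (length a) < faults k c τ + length c →
                       Returns x b τ
tracked-page-returns {k} x k≥1 a b c≡ (_ , c≤k) [] h =
  contradiction (≤-trans c≤k (m≤m+n k (suc (length a)))) (<⇒≱ h)
tracked-page-returns {k} x k≥1 {c} a b c≡ v (p ∷ τ) h with stepView k≥1 (proj₂ v) p
... | hit _ e =
  returns-∷ (tracked-page-returns x k≥1 a b c≡ v τ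
               (≤-trans h (≤-reflexive (cong (_+ length c) (faults-step c p τ e)))))
... | fill p∉c c<k e =
  returns-snoc (tracked-page-returns x k≥1 a (b ++ [ p ]) c'≡ (fill-valid v p∉c c<k) τ budget)
  where
  c'≡ : c ++ [ p ] ≡ a ++ x ∷ (b ++ [ p ])
  c'≡ = trans (cong (_++ [ p ]) c≡) (++-assoc a (x ∷ b) [ p ])

  budget : k + suc (length a) < faults k (c ++ [ p ]) τ + length (c ++ [ p ])
  budget = begin-strict
    k + suc (length a)                            <⟨ s≤s (fault-bound c p τ e h) ⟩
    suc (faults k (c ++ [ p ]) τ + length c)      ≡⟨ sym (+-suc _ (length c)) ⟩
    faults k (c ++ [ p ]) τ + suc (length c)      ≡⟨ cong (faults k (c ++ [ p ]) τ +_)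
                                                          (sym (length-snoc c p)) ⟩
    faults k (c ++ [ p ]) τ + length (c ++ [ p ]) ∎
    where open ≤-Reasoning
tracked-page-returns {k} x k≥1 [] b refl v (p ∷ τ) h | evict p∉c c≡k e =
  evicted-page-returns k≥1 v p∉c c≡k τ
    (+-cancelʳ-≤ k 1 _ (subst₂ (λ m l → m ≤ faults k (b ++ [ p ]) τ + l) (+-comm k 1) c≡k
                                (fault-bound (x ∷ b) p τ e h)))
tracked-page-returns {k} x k≥1 (a₀ ∷ a) b refl v (p ∷ τ) h | evict p∉c c≡k e =
  returns-snoc (tracked-page-returns x k≥1 a (b ++ [ p ]) (++-assoc a (x ∷ b) [ p ])
                                     (evict-valid v p∉c) τ budget)
  where
  cs : List (Fin (suc k))
  cs = a ++ x ∷ b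

  budget : k + suc (length a) < faults k (cs ++ [ p ]) τ + length (cs ++ [ p ])
  budget = begin
    suc (k + suc (length a))              ≡⟨ sym (+-suc k (suc (length a))) ⟩
    k + suc (suc (length a))              ≤⟨ fault-bound (a₀ ∷ cs) p τ e h ⟩
    faults k (cs ++ [ p ]) τ + suc (length cs) ≡⟨ cong (faults k (cs ++ [ p ]) τ +_)
                                                      (sym (length-snoc cs p)) ⟩
    faults k (cs ++ [ p ]) τ + length (cs ++ [ p ]) ∎
    where open ≤-Reasoning

-- After a fault on p, which puts p last in the queue c ++ [ p ], k + 1 more faults force
-- a return to p after every other page was requested: 2k + 1 requests in all.
after-first-fault : ∀ {k} {c : List (Fin (suc k))} {p} τ → 1 ≤ k → RespectsPath (p ∷ τ) →
                    Valid k (c ++ [ p ]) → suc k ≤ faults k (c ++ [ p ]) τ →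
                    suc (k + k) ≤ length (p ∷ τ)
after-first-fault {k} {c} {p} τ k≥1 r v h = finish (tracked-page-returns p k≥1 c [] refl v τ budget)
  where
  budget : k + suc (length c) < faults k (c ++ [ p ]) τ + length (c ++ [ p ])
  budget = subst (λ l → suc k + suc (length c) ≤ faults k (c ++ [ p ]) τ + l)
                 (sym (length-snoc c p)) (+-monoˡ-≤ (suc (length c)) h)

  finish : Returns p [] τ → suc (k + k) ≤ length (p ∷ τ)
  finish (w , rest , τ≡ , seen) =
    subst (λ t → suc (k + k) ≤ length (p ∷ t)) (sym τ≡)
          (return-trip p w rest (subst (RespectsPath ∘ (p ∷_)) τ≡ r)
                       (λ y y≢p → [ (λ ()) , (λ y∈w → y∈w) ]′ (seen y y≢p)))

fault-burst-length : ∀ {k} {c : List (Fin (suc k))} → 1 ≤ k → Valid k c → ∀ τ →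
                     RespectsPath τ → suc (suc k) ≤ faults k c τ → suc (k + k) ≤ length τ
fault-burst-length {k} {c} k≥1 v (p ∷ τ) r h with stepView k≥1 (proj₂ v) p
... | hit _ e =
  m≤n⇒m≤1+n (fault-burst-length k≥1 v τ (resp-tail r)
                                 (≤-trans h (≤-reflexive (faults-step c p τ e))))
... | fill p∉c c<k e = after-first-fault τ k≥1 r (fill-valid v p∉c c<k)
                         (s≤s⁻¹ (≤-trans h (≤-reflexive (faults-step c p τ e))))
... | evict p∉c _ e  = after-first-fault τ k≥1 r (evict-valid v p∉c)
                         (s≤s⁻¹ (≤-trans h (≤-reflexive (faults-step c p τ e))))

window-bound : ∀ {k} {c : List (Fin (suc k))} → 1 ≤ k → Valid k c → ∀ τ → RespectsPath τ →
               length τ ≤ 2 * k → faults k c τ ≤ suc k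
window-bound {k} {c} k≥1 v τ r τ≤2k with faults k c τ ≤? suc k
... | yes ok      = ok
... | no too-many =
  contradiction (≤-trans (fault-burst-length k≥1 v τ r (≰⇒> too-many)) τ≤2k)
                (subst (λ m → ¬ suc (k + k) ≤ k + m) (sym (+-identityʳ k)) 1+n≰n)

-- The bound holds for every window.
lemma5 : (k : ℕ) → 1 ≤ k → (σ : List (Fin (suc k))) → RespectsPath σ →
         (i : ℕ) → i + 2 * k ≤ length σ →
         countTrue (take (2 * k) (drop i (fifoFaults k σ))) ≤ suc k
lemma5 k k≥1 σ r i _ with suffix-run k≥1 ([] , z≤n) i σ
... | c , v , suffix = begin
  countTrue (take (2 * k) (drop i (fifoFaults k σ)))
    ≡⟨ cong (countTrue ∘ take (2 * k)) suffix ⟩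
  countTrue (take (2 * k) (fifoFaultsFrom k c (drop i σ)))
    ≡⟨ cong countTrue (take-run k (2 * k) c (drop i σ)) ⟩
  faults k c window
    ≤⟨ window-bound k≥1 v window window-resp window-length ⟩
  suc k
    ∎
  where
  open ≤-Reasoning
  window : List (Fin (suc k))
  window = take (2 * k) (drop i σ)

  window-resp : RespectsPath window
  window-resp = resp-take (2 * k) (resp-drop i r)

  window-length : length window ≤ 2 * k
  window-length = subst (_≤ 2 * k) (sym (length-take (2 * k) (drop i σ))) (m⊓n≤m (2 * k) _)
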